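{- Let $f,g,s,z$ be distinct alternatives and let $\mathcal D\subseteq\mathcal L(\{f,g,s,z\})$ be a peak-pit Condorcet domain with $R=fgsz\in\mathcal D$ and $T\in\mathcal D$ where $T\in\{zgsf,zsgf\}$, and such that $N_p(\mathcal D_{\{f,g,z\}})=\{gN_{\{f,g,z\}}1\}$. Let $\mathcal G=(G_1,\dots,G_k)$ be a geodesic on $\mathcal L(\{f,g,s\})$ connecting $R_{\{f,g,s\}}$ and $T_{\{f,g,s\}}$ such that $\mathcal D_{\{f,g,s\}}\cup\{G_1,\dots,G_k\}$ is a peak-pit Condorcet domain and $(f,g)$ is the first switching pair in $S(\mathcal G)$. Then $sN_{\{f,s,z\}}1\in N_p(\mathcal D_{\{f,s,z\}})$.
   Context: Linear orders are written as words from top to bottom; $\mathcal D_B$ is the set of restrictions of orders of $\mathcal D$ to $B$. For distinct $p,q,r$, $x\in\{p,q,r\}$, $k\in\{1,2,3\}$, a domain satisfies the never-condition $xN_{\{p,q,r\}}k$ if none of its orders restricted to $\{p,q,r\}$ has $x$ in position $k$; those with $k=1$ (never-top) or $k=3$ (never-bottom) are peak-pit conditions, and $N_p(\cdot)$ is the set of peak-pit conditions satisfied. A peak-pit Condorcet domain is a domain whose restriction to every triple of distinct alternatives satisfies at least one peak-pit condition. Two orders are alike if they differ by swapping two adjacent alternatives $x,y$ (switching pair $(x,y)$); a geodesic is a path of alike orders of minimum length between its endpoints, and $S(\mathcal G)$ is its sequence of switching pairs. -}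

module Defs where

open import Data.Fin using (Fin; zero; suc)
open import Data.Fin.Properties using (_≟_)
open import Data.Nat using (ℕ; zero; suc; _≤_)
open import Data.List using (List; []; _∷_; _++_; filter; length; head; last)
open import Data.List.Membership.DecPropositional (_≟_ {4}) using (_∈_; _∈?_)
open import Data.List.Relation.Binary.Permutation.Propositional using (_↭_)
open import Data.List.Relation.Unary.All using (All)
open import Data.List.Relation.Unary.Linked using (Linked)
open import Data.Maybe using (just)
open import Data.Product using (Σ; ∃; ∃-syntax; _×_; _,_)
open import Data.Sum using (_⊎_)
open import Relation.Nullary using (¬_)
open import Relation.Binary.PropositionalEquality using (_≡_; _≢_)

Alt : Set
Alt = Fin 4

f g s z : Alt
f = zero
g = suc zero
s = suc (suc zero)
z = suc (suc (suc zero))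

-- An order is written as a word from top to bottom.
Order : Set
Order = List Alt

Domain : Set₁
Domain = Order → Set

-- A set of alternatives given by a list; L(B) = orders that are permutations of B.
InL : List Alt → Order → Set
InL B o = o ↭ B

restrict : List Alt → Order → Order
restrict B o = filter (_∈? B) o

Restr : Domain → List Alt → Domain
Restr D B o = ∃[ l ] (D l × restrict B l ≡ o)

-- x occupies position k (0-based: k = 0 is top) in the word
AtPos : Order → ℕ → Alt → Set
AtPos []       _       x = Data.Empty.⊥
  where import Data.Empty
AtPos (y ∷ ys) zero    x = y ≡ x
AtPos (y ∷ ys) (suc k) x = AtPos ys k x

-- never-condition  x N_{T} (k+1)  for a triple T (listed as a list of 3 alternatives)
Never : Domain → Alt → List Alt → ℕ → Set
Never D x T k = ∀ o → D o → ¬ AtPos (restrict T o) k x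

-- peak-pit positions: never-top (k = 0) or never-bottom (k = 2)
PeakPitPos : ℕ → Set
PeakPitPos k = k ≡ 0 ⊎ k ≡ 2

InNp : Domain → List Alt → Alt → ℕ → Set
InNp D T x k = x ∈ T × PeakPitPos k × Never D x T k

PeakPitCD : Domain → List Alt → Set
PeakPitCD D B =
  ∀ p q r → p ∈ B → q ∈ B → r ∈ B → p ≢ q → q ≢ r → p ≢ r →
  ∃[ x ] ∃[ k ] InNp D (p ∷ q ∷ r ∷ []) x k

AlikeVia : Alt → Alt → Order → Order → Set
AlikeVia x y o o' = ∃[ xs ] ∃[ ys ] (o ≡ xs ++ x ∷ y ∷ ys × o' ≡ xs ++ y ∷ x ∷ ys)

Alike : Order → Order → Set
Alike o o' = ∃[ x ] ∃[ y ] AlikeVia x y o o'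

Path : List Alt → List Order → Set
Path B G = All (InL B) G × Linked Alike G

Connects : List Order → Order → Order → Set
Connects G a b = head G ≡ just a × last G ≡ just b

Geodesic : List Alt → List Order → Order → Order → Set
Geodesic B G a b =
  Path B G × Connects G a b ×
  (∀ G' → Path B G' → Connects G' a b → length G ≤ length G')

FirstSwitch : List Order → Alt → Alt → Set
FirstSwitch G x y =
  ∃[ G₁ ] ∃[ G₂ ] ∃[ rest ] (G ≡ G₁ ∷ G₂ ∷ rest × AlikeVia x y G₁ G₂)

Union : Domain → List Order → Domain
Union D G o = D o ⊎ Data.List.Membership.Propositional._∈_ o G
  where import Data.List.Membership.Propositional

fgsz fgs fgz fsz : List Alt
fgsz = f ∷ g ∷ s ∷ z ∷ []
fgs = f ∷ g ∷ s ∷ []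
fgz = f ∷ g ∷ z ∷ []
fsz = f ∷ s ∷ z ∷ []

{-# OPTIONS --safe #-}
-- On the triple {f,s,z} the domain contains R|fsz = fsz and its reverse T|fsz = zsf, so its
-- only possible peak-pit conditions are sN1 and sN3. On {f,g,s} the geodesic starts fgs, gfs
-- and T|fgs has f at the bottom, so D|fgs satisfies sN1 or gN3. If D satisfies sN3 on fsz,
-- then sN1 on fgs forces sN1 on fsz (by gN1 on fgz), while gN3 on fgs would force gN3 on fgz,
-- which the hypothesis N_p(D|fgz) = {gN1} forbids.
module Submission where

open import Defs
open import Data.Empty using (⊥-elim)
open import Data.Fin using (zero; suc)
open import Data.Fin.Properties using (_≟_; all?)
open import Data.List using (List; []; _∷_; length; head)
open import Data.List.Membership.DecPropositional (_≟_ {4}) using (_∈_; _∈?_)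
open import Data.List.Membership.Propositional using () renaming (_∈_ to _∈ᴸ_)
open import Data.List.Properties using (filter-idem)
open import Data.List.Relation.Binary.Permutation.Propositional using (↭-sym)
open import Data.List.Relation.Binary.Permutation.Propositional.Properties using (↭-length; ∈-resp-↭)
open import Data.List.Relation.Unary.Any using (here; there)
open import Data.Maybe using (just)
open import Data.Nat using (ℕ; zero; suc)
open import Data.Nat.Properties using (1+n≢0)
open import Data.Product using (∃-syntax; _×_; _,_; proj₁; proj₂; uncurry)
open import Data.Sum using (_⊎_; inj₁; inj₂)
open import Relation.Binary.PropositionalEquality using (_≡_; refl; sym; subst)
open import Relation.Nullary using (Dec; no; ¬_; ¬?)
open import Relation.Nullary.Decidable using (True; toWitness; _→-dec_)

AtPos? : ∀ o k x → Dec (AtPos o k x)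
AtPos? []       k       x = no λ ()
AtPos? (y ∷ ys) zero    x = y ≟ x
AtPos? (y ∷ ys) (suc k) x = AtPos? ys k x

AtPos-≡ : ∀ {w w′ k x} → w ≡ w′ → AtPos w′ k x → AtPos w k x
AtPos-≡ {k = k} {x} w≡w′ = subst (λ v → AtPos v k x) (sym w≡w′)

Never-Restr⁻ : ∀ {D x B k} → Never (Restr D B) x B k → Never D x B k
Never-Restr⁻ {B = B} nv o d at = nv (restrict B o) (o , d , refl) (AtPos-≡ (filter-idem (_∈? B) o) at)

Never-Restr⁺ : ∀ {D x B k} → Never D x B k → Never (Restr D B) x B k
Never-Restr⁺ {B = B} nv .(restrict B o) (o , d , refl) at = nv o d (AtPos-≡ (sym (filter-idem (_∈? B) o)) at)

Never-Union⁻ : ∀ {D G x B k} → Never (Union D G) x B k → Never D x B k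
Never-Union⁻ nv o d = nv o (inj₁ d)

Spans : Order → Set
Spans o = ∀ x → x ∈ o

∈-fgsz : ∀ x → x ∈ fgsz
∈-fgsz zero                   = here refl
∈-fgsz (suc zero)             = there (here refl)
∈-fgsz (suc (suc zero))       = there (there (here refl))
∈-fgsz (suc (suc (suc zero))) = there (there (there (here refl)))

AllSpanningWords₄ : (Order → Set) → Set
AllSpanningWords₄ P = ∀ a b c d → Spans (a ∷ b ∷ c ∷ d ∷ []) → P (a ∷ b ∷ c ∷ d ∷ [])

allSpanningWords₄? : ∀ {P : Order → Set} → (∀ o → Dec (P o)) → Dec (AllSpanningWords₄ P)
allSpanningWords₄? P? =
  all? λ a → all? λ b → all? λ c → all? λ d →
    all? (_∈? (a ∷ b ∷ c ∷ d ∷ [])) →-dec P? (a ∷ b ∷ c ∷ d ∷ [])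

AllSpanningWords₄⇒L-fgsz : ∀ {P : Order → Set} → AllSpanningWords₄ P → ∀ o → InL fgsz o → P o
AllSpanningWords₄⇒L-fgsz {P} h o o↭fgsz =
  go o (↭-length o↭fgsz) (λ x → ∈-resp-↭ (↭-sym o↭fgsz) (∈-fgsz x))
  where
  go : ∀ o → length o ≡ 4 → Spans o → P o
  go (a ∷ b ∷ c ∷ d ∷ []) refl = h a b c d

L-fgsz-by-enumeration : ∀ {P : Order → Set} (P? : ∀ o → Dec (P o)) → {True (allSpanningWords₄? P?)} →
  ∀ o → InL fgsz o → P o
L-fgsz-by-enumeration P? {ok} = AllSpanningWords₄⇒L-fgsz (toWitness ok)

-- If s is on top of {f,s,z} but not of {f,g,s}, then g is above s, hence on top of {f,g,z}.
never-top-transfer : ∀ {D} → (∀ o → D o → InL fgsz o) →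
  Never D s fgs 0 → Never D g fgz 0 → Never D s fsz 0
never-top-transfer inL sN1 gN1 o d = check o (inL o d) (sN1 o d) (gN1 o d)
  where
  check : ∀ o → InL fgsz o →
    ¬ AtPos (restrict fgs o) 0 s → ¬ AtPos (restrict fgz o) 0 g → ¬ AtPos (restrict fsz o) 0 s
  check = L-fgsz-by-enumeration λ o →
    ¬? (AtPos? (restrict fgs o) 0 s) →-dec
    (¬? (AtPos? (restrict fgz o) 0 g) →-dec ¬? (AtPos? (restrict fsz o) 0 s))

-- If g is at the bottom of {f,g,z} but not of {f,g,s}, then s is below g, hence at the bottom of {f,s,z}.
never-bottom-transfer : ∀ {D} → (∀ o → D o → InL fgsz o) →
  Never D g fgs 2 → Never D s fsz 2 → Never D g fgz 2
never-bottom-transfer inL gN3 sN3 o d = check o (inL o d) (gN3 o d) (sN3 o d)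
  where
  check : ∀ o → InL fgsz o →
    ¬ AtPos (restrict fgs o) 2 g → ¬ AtPos (restrict fsz o) 2 s → ¬ AtPos (restrict fgz o) 2 g
  check = L-fgsz-by-enumeration λ o →
    ¬? (AtPos? (restrict fgs o) 2 g) →-dec
    (¬? (AtPos? (restrict fsz o) 2 s) →-dec ¬? (AtPos? (restrict fgz o) 2 g))

reverse-pair⇒middle-conditions : ∀ {D p q r o o′} →
  ∃[ x ] ∃[ k ] InNp D (p ∷ q ∷ r ∷ []) x k →
  D o  → restrict (p ∷ q ∷ r ∷ []) o  ≡ p ∷ q ∷ r ∷ [] →
  D o′ → restrict (p ∷ q ∷ r ∷ []) o′ ≡ r ∷ q ∷ p ∷ [] →
  Never D q (p ∷ q ∷ r ∷ []) 0 ⊎ Never D q (p ∷ q ∷ r ∷ []) 2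
reverse-pair⇒middle-conditions {o = o} {o′} cond d o≡pqr d′ o′≡rqp with cond
... | _ , _ , here refl                 , inj₁ refl , nv = ⊥-elim (nv o  d  (AtPos-≡ o≡pqr refl))
... | _ , _ , here refl                 , inj₂ refl , nv = ⊥-elim (nv o′ d′ (AtPos-≡ o′≡rqp refl))
... | _ , _ , there (here refl)         , inj₁ refl , nv = inj₁ nv
... | _ , _ , there (here refl)         , inj₂ refl , nv = inj₂ nv
... | _ , _ , there (there (here refl)) , inj₁ refl , nv = ⊥-elim (nv o′ d′ (AtPos-≡ o′≡rqp refl))
... | _ , _ , there (there (here refl)) , inj₂ refl , nv = ⊥-elim (nv o  d  (AtPos-≡ o≡pqr refl))

AlikeVia-fg-fgs : ∀ {o} → AlikeVia f g fgs o → o ≡ g ∷ f ∷ s ∷ []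
AlikeVia-fg-fgs ([]                    , _ , refl , refl) = refl
AlikeVia-fg-fgs (_ ∷ []                , _ , ()   , _)
AlikeVia-fg-fgs (_ ∷ _ ∷ []            , _ , ()   , _)
AlikeVia-fg-fgs (_ ∷ _ ∷ _ ∷ []        , _ , ()   , _)
AlikeVia-fg-fgs (_ ∷ _ ∷ _ ∷ _ ∷ _     , _ , ()   , _)

firstSwitch-fg-from-fgs : ∀ {G} → FirstSwitch G f g → head G ≡ just fgs →
  fgs ∈ᴸ G × (g ∷ f ∷ s ∷ []) ∈ᴸ G
firstSwitch-fg-from-fgs (_ , _ , _ , refl , alike) refl with AlikeVia-fg-fgs alike
... | refl = here refl , there (here refl)

fgs-conditions : ∀ {D G T} → PeakPitCD (Union (Restr D fgs) G) fgs →
  fgs ∈ᴸ G → (g ∷ f ∷ s ∷ []) ∈ᴸ G → D T → AtPos (restrict fgs T) 2 f →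
  Never D s fgs 0 ⊎ Never D g fgs 2
fgs-conditions {T = T} pp fgs∈G gfs∈G dT f-bottom
  with pp f g s (here refl) (there (here refl)) (there (there (here refl))) (λ ()) (λ ()) (λ ())
... | _ , _ , here refl                 , inj₁ refl , nv = ⊥-elim (nv fgs (inj₂ fgs∈G) refl)
... | _ , _ , here refl                 , inj₂ refl , nv =
  ⊥-elim (Never-Restr⁻ (Never-Union⁻ nv) T dT f-bottom)
... | _ , _ , there (here refl)         , inj₁ refl , nv = ⊥-elim (nv _ (inj₂ gfs∈G) refl)
... | _ , _ , there (here refl)         , inj₂ refl , nv = inj₂ (Never-Restr⁻ (Never-Union⁻ nv))
... | _ , _ , there (there (here refl)) , inj₁ refl , nv = inj₁ (Never-Restr⁻ (Never-Union⁻ nv))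
... | _ , _ , there (there (here refl)) , inj₂ refl , nv = ⊥-elim (nv fgs (inj₂ fgs∈G) refl)

zgsf/zsgf-restrict-fsz : ∀ {T} → T ≡ z ∷ g ∷ s ∷ f ∷ [] ⊎ T ≡ z ∷ s ∷ g ∷ f ∷ [] →
  restrict fsz T ≡ z ∷ s ∷ f ∷ []
zgsf/zsgf-restrict-fsz (inj₁ refl) = refl
zgsf/zsgf-restrict-fsz (inj₂ refl) = refl

zgsf/zsgf-f-bottom-fgs : ∀ {T} → T ≡ z ∷ g ∷ s ∷ f ∷ [] ⊎ T ≡ z ∷ s ∷ g ∷ f ∷ [] →
  AtPos (restrict fgs T) 2 f
zgsf/zsgf-f-bottom-fgs (inj₁ refl) = refl
zgsf/zsgf-f-bottom-fgs (inj₂ refl) = refl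

lemma16 :
    (D : Domain) →
    (∀ o → D o → InL fgsz o) →
    PeakPitCD D fgsz →
    D (f ∷ g ∷ s ∷ z ∷ []) →
    (T : Order) →
    (T ≡ z ∷ g ∷ s ∷ f ∷ [] ⊎ T ≡ z ∷ s ∷ g ∷ f ∷ []) →
    D T →
    (∀ (x : Alt) (k : ℕ) →
      (InNp (Restr D fgz) fgz x k → x ≡ g × k ≡ 0) ×
      (x ≡ g × k ≡ 0 → InNp (Restr D fgz) fgz x k)) →
    (G : List Order) →
    Geodesic fgs G (restrict fgs (f ∷ g ∷ s ∷ z ∷ [])) (restrict fgs T) →
    PeakPitCD (Union (Restr D fgs) G) fgs →
    FirstSwitch G f g →
    InNp (Restr D fsz) fsz s 0
lemma16 D inL pp dR T T≡ dT Np-fgz G (_ , (starts-fgs , _) , _) ppU first =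
  there (here refl) , inj₁ refl , Never-Restr⁺ sN1-fsz
  where
  gN1-fgz : Never D g fgz 0
  gN1-fgz = Never-Restr⁻ (proj₂ (proj₂ (proj₂ (Np-fgz g 0) (refl , refl))))

  ¬gN3-fgz : ¬ Never D g fgz 2
  ¬gN3-fgz gN3 = 1+n≢0 (proj₂ (proj₁ (Np-fgz g 2) (there (here refl) , inj₂ refl , Never-Restr⁺ gN3)))

  sN1-fsz : Never D s fsz 0
  sN1-fsz
    with reverse-pair⇒middle-conditions
           (pp f s z (here refl) (there (there (here refl))) (there (there (there (here refl))))
               (λ ()) (λ ()) (λ ()))
           dR refl dT (zgsf/zsgf-restrict-fsz T≡)
       | uncurry (fgs-conditions ppU) (firstSwitch-fg-from-fgs first starts-fgs) dT
           (zgsf/zsgf-f-bottom-fgs T≡)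
  ... | inj₁ sN1     | _            = sN1
  ... | inj₂ _       | inj₁ sN1-fgs = never-top-transfer inL sN1-fgs gN1-fgz
  ... | inj₂ sN3-fsz | inj₂ gN3-fgs = ⊥-elim (¬gN3-fgz (never-bottom-transfer inL gN3-fgs sN3-fsz))
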